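{- Let $P$ be a positive integer, $S'\subset\mathbb{Z}/P\mathbb{Z}$ with $S'=-S'$, $0\in S'$ and $\operatorname{card}(S')\le t$, let $B\subset\mathbb{Z}/P\mathbb{Z}$, $l\ge1$ and $1\le r\le l$. Then the number of $\tilde y\in B^l$ with $C(G(\tilde y))=r$ is at most $c(t,r)\operatorname{card}(B)^r$ with $c(t,r)=\binom lr(rt)^{2l^2}$.
   Context: For $\tilde y=(y_1,\dots,y_l)\in B^l$, $G(\tilde y)$ is the graph with vertex set $\{y_1,\dots,y_l\}$ in which $y_i,y_j$ are adjacent iff $y_i-y_j\in S'$; $C(G(\tilde y))$ is its number of connected components. -}

module Defs where

open import Data.Nat using (ℕ; zero; suc; _+_; _*_; _∸_; _^_; _≤_; NonZero)
open import Data.Nat.DivMod using (_mod_)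
open import Data.Fin using (Fin; toℕ)
open import Data.Fin.Subset using (Subset; _∈_; ∣_∣)
open import Data.Vec using (Vec; lookup)
open import Data.List using (List; length)
open import Data.List.Relation.Unary.All using (All)
open import Data.List.Relation.Unary.Unique.Propositional using (Unique)
open import Data.Product using (Σ; ∃; _×_)
open import Relation.Binary.PropositionalEquality using (_≡_; _≢_)
open import Relation.Nullary using (¬_)

-- ℤ/Pℤ is represented by Fin P (P positive, i.e. NonZero P), with the
-- usual residue arithmetic.
module _ (P : ℕ) .{{_ : NonZero P}} where

  zeroP : Fin P
  zeroP = 0 mod P

  subP : Fin P → Fin P → Fin P
  subP x y = (toℕ x + (P ∸ toℕ y)) mod P

  negP : Fin P → Fin P
  negP x = subP zeroP x

module _ {P : ℕ} .{{_ : NonZero P}} {l : ℕ} where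

  -- The vertex set {y_1,…,y_l} of G(ỹ): the residues occurring in ỹ.
  Vertex : Vec (Fin P) l → Fin P → Set
  Vertex y v = ∃ λ (i : Fin l) → lookup y i ≡ v

  Adj : Subset P → Fin P → Fin P → Set
  Adj S' u v = subP P u v ∈ S'

  data Connected (S' : Subset P) (y : Vec (Fin P) l) : Fin P → Fin P → Set where
    here : ∀ {u} → Vertex y u → Connected S' y u u
    step : ∀ {u w v} → Vertex y u → Adj S' u w → Connected S' y w v →
           Connected S' y u v

  -- C(G(ỹ)) = r : the graph G(ỹ) has exactly r connected components,
  -- i.e. there are r vertices, pairwise in different components, such
  -- that every vertex lies in the component of one of them.
  HasComponents : Subset P → Vec (Fin P) l → ℕ → Set
  HasComponents S' y r =
    Σ (Vec (Fin P) r) λ reps →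
      ((k : Fin r) → Vertex y (lookup reps k)) ×
      ((k k' : Fin r) → k ≢ k' →
         ¬ Connected S' y (lookup reps k) (lookup reps k')) ×
      ((v : Fin P) → Vertex y v → ∃ λ (k : Fin r) → Connected S' y v (lookup reps k))

  InPow : Subset P → Vec (Fin P) l → Set
  InPow B y = (i : Fin l) → lookup y i ∈ B

-- "number of ỹ with property Q is at most N": every duplicate-free list
-- of such ỹ has length ≤ N.
CountAtMost : {A : Set} → (A → Set) → ℕ → Set
CountAtMost {A} Q N = (L : List A) → Unique L → All Q L → length L ≤ N

module Submission where

-- Let ỹ ∈ B^l be such that
-- G(ỹ) has r components, with representatives ρ₁,…,ρ_r (vertices of G(ỹ),
-- hence elements of B).  Each entry y_i is joined to some ρ_k by a path in
-- G(ỹ); shortening it to a simple path leaves at most l vertices, so the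
-- successive differences of its vertices form a sequence in S' of length at
-- most l - 1, which we pad to length l with zero steps (0 ∈ S').  Since
-- x ↦ x - w is injective on ℤ/Pℤ, y_i is recovered from ρ_k and that
-- difference sequence by walking backwards.  Hence
--     ỹ ↦ (ρ , (k_i , differences_i)_{i ≤ l})
-- is injective into B^r × ([r] × S'^l)^l, a set of size |B|^r (r |S'|^l)^l,
-- and this is at most C(l,r) (rt)^(2l²) |B|^r.

open import Defs
open import Data.Nat using (ℕ; _+_; _*_; _^_; _≤_; NonZero)
open import Data.Nat.Combinatorics using (_C_)
open import Data.Fin using (Fin)
open import Data.Fin.Subset using (Subset; _∈_; ∣_∣)
open import Data.Vec using (Vec)
open import Data.Product using (_×_)

open import Function using (_∘_)
open import Data.Nat using (zero; suc; _∸_; _%_; z≤n; s≤s; >-nonZero; >-nonZero⁻¹)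
open import Data.Nat.Properties
open import Data.Nat.DivMod
  using (_mod_; %-distribˡ-+; m%n%n≡m%n; [m+n]%n≡m%n; m<n⇒m%n≡m; n%n≡0; m%n<n)
open import Data.Nat.Combinatorics using (nCk+nC[k+1]≡[n+1]C[k+1])
import Data.Fin as F
open import Data.Fin using (toℕ)
open import Data.Fin.Properties using (toℕ-fromℕ<; toℕ-injective; toℕ<n)
open import Data.Fin.Subset using (inside; outside)
open import Data.Fin.Subset.Properties using (p⊆q⇒∣p∣≤∣q∣; ∣⁅x⁆∣≡1; x∈⁅y⁆⇒x≡y)
open import Data.Vec using ([]; _∷_; lookup; tabulate; replicate)
open import Data.Vec.Properties using (lookup∘tabulate; tabulate∘lookup; tabulate-cong; lookup-replicate)
open import Data.List using (List; []; _∷_; length; map; _++_; allFin; cartesianProduct; cartesianProductWith)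
open import Data.List.Properties using (length-map; length-++; length-tabulate)
open import Data.List.Membership.Propositional renaming (_∈_ to _∈ₗ_)
open import Data.List.Membership.Propositional.Properties
  using (∈-map⁺; ∈-allFin; ∈-cartesianProduct⁺; ∈-cartesianProductWith⁺)
open import Data.List.Relation.Unary.All as All using (All; []; _∷_)
open import Data.List.Relation.Unary.All.Properties using (¬Any⇒All¬)
open import Data.List.Relation.Unary.Any using (here; there)
open import Data.List.Relation.Unary.AllPairs using ([]; _∷_)
open import Data.List.Relation.Unary.Unique.Propositional using (Unique)
open import Data.Product using (Σ; ∃; _,_; proj₁; proj₂)
open import Relation.Binary.PropositionalEquality
open import Relation.Nullary using (yes; no)
open import Data.Empty using (⊥-elim)

-- Counting by injective encoding

remove : {A : Set} {x : A} (ys : List A) → x ∈ₗ ys → List A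
remove (y ∷ ys) (here _)  = ys
remove (y ∷ ys) (there p) = y ∷ remove ys p

length-remove : {A : Set} {x : A} (ys : List A) (p : x ∈ₗ ys) →
                length ys ≡ suc (length (remove ys p))
length-remove (y ∷ ys) (here _)  = refl
length-remove (y ∷ ys) (there p) = cong suc (length-remove ys p)

∈-remove : {A : Set} {x z : A} (ys : List A) (p : x ∈ₗ ys) →
           z ∈ₗ ys → x ≢ z → z ∈ₗ remove ys p
∈-remove (y ∷ ys) (here refl) (here refl) x≢z = ⊥-elim (x≢z refl)
∈-remove (y ∷ ys) (here refl) (there q)   _   = q
∈-remove (y ∷ ys) (there p)   (here refl) _   = here refl
∈-remove (y ∷ ys) (there p)   (there q)   x≢z = there (∈-remove ys p q x≢z)

unique-⊆⇒length≤ : {A : Set} (xs ys : List A) →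
                   Unique xs → All (_∈ₗ ys) xs → length xs ≤ length ys
unique-⊆⇒length≤ []       ys _             _          = z≤n
unique-⊆⇒length≤ (x ∷ xs) ys (x∉xs ∷ uniq) (x∈ys ∷ xs⊆ys) =
  subst (suc (length xs) ≤_) (sym (length-remove ys x∈ys))
    (s≤s (unique-⊆⇒length≤ xs (remove ys x∈ys) uniq
           (All.zipWith (λ { (x≢z , z∈ys) → ∈-remove ys x∈ys z∈ys x≢z }) (x∉xs , xs⊆ys))))

count-by-encoding : {A C : Set} {Q : A → Set} (code : (x : A) → Q x → C) →
                    (∀ x x' (q : Q x) (q' : Q x') → code x q ≡ code x' q' → x ≡ x') →
                    (M : List C) → (∀ x (q : Q x) → code x q ∈ₗ M) →
                    CountAtMost Q (length M)
count-by-encoding {A} {C} {Q} code injective M code∈M L uniq qs =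
  subst (_≤ length M) (length-codes L qs)
    (unique-⊆⇒length≤ (codes L qs) M (codes-unique L qs uniq) (codes-in L qs))
  where
  codes : (L : List A) → All Q L → List C
  codes []       []       = []
  codes (x ∷ xs) (q ∷ qs) = code x q ∷ codes xs qs

  length-codes : (L : List A) (qs : All Q L) → length (codes L qs) ≡ length L
  length-codes []       []       = refl
  length-codes (x ∷ xs) (q ∷ qs) = cong suc (length-codes xs qs)

  codes-fresh : ∀ x (q : Q x) (L : List A) (qs : All Q L) →
                All (x ≢_) L → All (code x q ≢_) (codes L qs)
  codes-fresh x q []       []        []           = []
  codes-fresh x q (y ∷ ys) (q' ∷ qs) (x≢y ∷ x∉ys) =
    (λ same → x≢y (injective x y q q' same)) ∷ codes-fresh x q ys qs x∉ys

  codes-unique : (L : List A) (qs : All Q L) → Unique L → Unique (codes L qs)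
  codes-unique []       []       []            = []
  codes-unique (x ∷ xs) (q ∷ qs) (x∉xs ∷ uniq) = codes-fresh x q xs qs x∉xs ∷ codes-unique xs qs uniq

  codes-in : (L : List A) (qs : All Q L) → All (_∈ₗ M) (codes L qs)
  codes-in []       []       = []
  codes-in (x ∷ xs) (q ∷ qs) = code∈M x q ∷ codes-in xs qs

count-weaken : {A : Set} {Q : A → Set} {N N' : ℕ} → N ≤ N' → CountAtMost Q N → CountAtMost Q N'
count-weaken N≤N' bound L uniq qs = ≤-trans (bound L uniq qs) N≤N'

length-cartesianProductWith : {A B C : Set} (f : A → B → C) (xs : List A) (ys : List B) →
                              length (cartesianProductWith f xs ys) ≡ length xs * length ys
length-cartesianProductWith f []       ys = refl
length-cartesianProductWith f (x ∷ xs) ys = begin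
  length (map (f x) ys ++ cartesianProductWith f xs ys)
    ≡⟨ length-++ (map (f x) ys) ⟩
  length (map (f x) ys) + length (cartesianProductWith f xs ys)
    ≡⟨ cong₂ _+_ (length-map (f x) ys) (length-cartesianProductWith f xs ys) ⟩
  length ys + length xs * length ys ∎
  where open ≡-Reasoning

vectorsOver : {A : Set} → List A → (n : ℕ) → List (Vec A n)
vectorsOver xs zero    = [] ∷ []
vectorsOver xs (suc n) = cartesianProductWith _∷_ xs (vectorsOver xs n)

length-vectorsOver : {A : Set} (xs : List A) (n : ℕ) → length (vectorsOver xs n) ≡ length xs ^ n
length-vectorsOver xs zero    = refl
length-vectorsOver xs (suc n) =
  trans (length-cartesianProductWith _∷_ xs (vectorsOver xs n)) (cong (length xs *_) (length-vectorsOver xs n))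

∈-vectorsOver : {A : Set} {xs : List A} {n : ℕ} (v : Vec A n) →
                ((j : Fin n) → lookup v j ∈ₗ xs) → v ∈ₗ vectorsOver xs n
∈-vectorsOver []      _       = here refl
∈-vectorsOver (x ∷ v) entries =
  ∈-cartesianProductWith⁺ _∷_ (entries F.zero) (∈-vectorsOver v (entries ∘ F.suc))

members : {n : ℕ} → Subset n → List (Fin n)
members []            = []
members (inside ∷ p)  = F.zero ∷ map F.suc (members p)
members (outside ∷ p) = map F.suc (members p)

length-members : {n : ℕ} (p : Subset n) → length (members p) ≡ ∣ p ∣
length-members []            = refl
length-members (inside ∷ p)  = cong suc (trans (length-map F.suc (members p)) (length-members p))
length-members (outside ∷ p) = trans (length-map F.suc (members p)) (length-members p)

∈-members : {n : ℕ} {p : Subset n} {x : Fin n} → x ∈ p → x ∈ₗ members p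
∈-members {p = inside ∷ p}  Data.Vec.here       = here refl
∈-members {p = inside ∷ p}  (Data.Vec.there x∈p) = there (∈-map⁺ F.suc (∈-members x∈p))
∈-members {p = outside ∷ p} (Data.Vec.there x∈p) = ∈-map⁺ F.suc (∈-members x∈p)

member⇒size-positive : {n : ℕ} {p : Subset n} {x : Fin n} → x ∈ p → 1 ≤ ∣ p ∣
member⇒size-positive {p = p} {x} x∈p =
  subst (_≤ ∣ p ∣) (∣⁅x⁆∣≡1 x)
    (p⊆q⇒∣p∣≤∣q∣ (λ {y} y∈⁅x⁆ → subst (_∈ p) (sym (x∈⁅y⁆⇒x≡y x y∈⁅x⁆)) x∈p))

module Residues (P : ℕ) .{{_ : NonZero P}} where

  toℕ-mod : ∀ m → toℕ (m mod P) ≡ m % P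
  toℕ-mod m = toℕ-fromℕ< (m%n<n m P)

  subP-+-cancel : (u w : Fin P) → (toℕ (subP P u w) + toℕ w) % P ≡ toℕ u
  subP-+-cancel u w = begin
    (toℕ (subP P u w) + c) % P      ≡⟨ cong (λ z → (z + c) % P) (toℕ-mod (a + (P ∸ c))) ⟩
    ((a + (P ∸ c)) % P + c) % P     ≡⟨ %-distribˡ-+ ((a + (P ∸ c)) % P) c P ⟩
    ((a + (P ∸ c)) % P % P + c % P) % P
                                    ≡⟨ cong (λ z → (z + c % P) % P) (m%n%n≡m%n (a + (P ∸ c)) P) ⟩
    ((a + (P ∸ c)) % P + c % P) % P ≡⟨ %-distribˡ-+ (a + (P ∸ c)) c P ⟨
    (a + (P ∸ c) + c) % P           ≡⟨ cong (_% P) (+-assoc a (P ∸ c) c) ⟩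
    (a + ((P ∸ c) + c)) % P         ≡⟨ cong (λ z → (a + z) % P) (m∸n+n≡m (<⇒≤ (toℕ<n w))) ⟩
    (a + P) % P                     ≡⟨ [m+n]%n≡m%n a P ⟩
    a % P                           ≡⟨ m<n⇒m%n≡m (toℕ<n u) ⟩
    a ∎
    where
    open ≡-Reasoning
    a = toℕ u
    c = toℕ w

  subP-cancelʳ : {u u' w : Fin P} → subP P u w ≡ subP P u' w → u ≡ u'
  subP-cancelʳ {u} {u'} {w} same = toℕ-injective (begin
    toℕ u                              ≡⟨ subP-+-cancel u w ⟨
    (toℕ (subP P u w) + toℕ w) % P     ≡⟨ cong (λ z → (toℕ z + toℕ w) % P) same ⟩
    (toℕ (subP P u' w) + toℕ w) % P    ≡⟨ subP-+-cancel u' w ⟩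
    toℕ u' ∎)
    where open ≡-Reasoning

  subP-self : (v : Fin P) → subP P v v ≡ zeroP P
  subP-self v = toℕ-injective (begin
    toℕ (subP P v v)         ≡⟨ toℕ-mod (toℕ v + (P ∸ toℕ v)) ⟩
    (toℕ v + (P ∸ toℕ v)) % P ≡⟨ cong (_% P) (m+[n∸m]≡n (<⇒≤ (toℕ<n v))) ⟩
    P % P                    ≡⟨ n%n≡0 P ⟩
    0                        ≡⟨ m<n⇒m%n≡m (>-nonZero⁻¹ P) ⟨
    0 % P                    ≡⟨ toℕ-mod 0 ⟨
    toℕ (zeroP P) ∎)
    where open ≡-Reasoning

-- Difference sequences and paths in G(ỹ)

module Paths (P : ℕ) .{{_ : NonZero P}} (S' : Subset P) where
  open Residues P
  open import Data.List.Membership.DecPropositional (F._≟_ {P}) using (_∈?_)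

  data Differences : Fin P → Fin P → {n : ℕ} → Vec (Fin P) n → Set where
    stop : ∀ {v} → Differences v v []
    move : ∀ {u w v n s} {ss : Vec (Fin P) n} →
           subP P u w ≡ s → Differences w v ss → Differences u v (s ∷ ss)

  start-unique : ∀ {n} {u u' v v' : Fin P} {ss ss' : Vec (Fin P) n} →
                 Differences u v ss → Differences u' v' ss' → v ≡ v' → ss ≡ ss' → u ≡ u'
  start-unique stop          stop            refl refl = refl
  start-unique (move {w = w} u-w d) (move u'-w' d') refl refl
    with refl ← start-unique d d' refl refl = subP-cancelʳ {w = w} (trans u-w (sym u'-w'))

  stay : (n : ℕ) (v : Fin P) → Differences v v (replicate n (zeroP P))
  stay zero    v = stop
  stay (suc n) v = move (subP-self v) (stay n v)

  data Walk : Fin P → Fin P → List (Fin P) → Set where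
    arrive : ∀ {v} → Walk v v (v ∷ [])
    go     : ∀ {u w v vs} → subP P u w ∈ S' → Walk w v vs → Walk u v (u ∷ vs)

  walk-differences : zeroP P ∈ S' → (n : ℕ) → ∀ {u v vs} → Walk u v vs → length vs ≤ suc n →
                     Σ (Vec (Fin P) n) λ ss → Differences u v ss × ((j : Fin n) → lookup ss j ∈ S')
  walk-differences 0∈S' n {v = v} arrive _ =
    replicate n (zeroP P) , stay n v , λ j → subst (_∈ S') (sym (lookup-replicate j (zeroP P))) 0∈S'
  walk-differences 0∈S' zero    (go _ arrive)   (s≤s ())
  walk-differences 0∈S' zero    (go _ (go _ _)) (s≤s ())
  walk-differences 0∈S' (suc n) {u} (go {w = w} u-w∈S' walk) (s≤s short)
    with ss , d , ss∈S' ← walk-differences 0∈S' n walk short =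
    subP P u w ∷ ss , move refl d , λ { F.zero → u-w∈S' ; (F.suc j) → ss∈S' j }

  module _ {l : ℕ} (y : Vec (Fin P) l) where

    SimplePath : Fin P → Fin P → Set
    SimplePath u v = Σ (List (Fin P)) λ vs → Walk u v vs × Unique vs × All (Vertex y) vs

    suffix : ∀ {u w v vs} → Walk w v vs → Unique vs → All (Vertex y) vs → u ∈ₗ vs → SimplePath u v
    suffix arrive     uniq       vert       (here refl) = _ , arrive , uniq , vert
    suffix (go e walk) uniq      vert       (here refl) = _ , go e walk , uniq , vert
    suffix (go _ walk) (_ ∷ uniq) (_ ∷ vert) (there u∈vs) = suffix walk uniq vert u∈vs

    -- Connected vertices of G(ỹ) are joined by a simple path: when a vertex
    -- recurs, cut out the loop.
    simplify : ∀ {u v} → Connected S' y u v → SimplePath u v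
    simplify (here v-vert) = _ , arrive , [] ∷ [] , v-vert ∷ []
    simplify {u} (step u-vert e c) with vs , walk , uniq , vert ← simplify c | u ∈? vs
    ... | yes u∈vs = suffix walk uniq vert u∈vs
    ... | no  u∉vs = u ∷ vs , go e walk , ¬Any⇒All¬ vs u∉vs ∷ uniq , u-vert ∷ vert

    -- A simple path in G(ỹ) has at most l vertices, since G(ỹ) has at most
    -- l vertices (pigeonhole).
    simple-length : ∀ {vs} → Unique vs → All (Vertex y) vs → length vs ≤ l
    simple-length {vs} uniq vert =
      subst (length vs ≤_) (trans (length-map (lookup y) (allFin l)) (length-tabulate (λ i → i)))
        (unique-⊆⇒length≤ vs (map (lookup y) (allFin l)) uniq
          (All.map (λ { (i , refl) → ∈-map⁺ (lookup y) (∈-allFin i) }) vert))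

-- The encoding of tuples with r components

module ComponentCode (P : ℕ) .{{_ : NonZero P}} (S' : Subset P) (0∈S' : zeroP P ∈ S')
                     (B : Subset P) (l r : ℕ) where
  open Paths P S'

  record Anchor (reps : Vec (Fin P) r) (x : Fin P) : Set where
    constructor anchor
    field
      component : Fin r
      steps     : Vec (Fin P) l
      walk      : Differences x (lookup reps component) steps
      steps∈S'  : (j : Fin l) → lookup steps j ∈ S'
  open Anchor

  -- Every entry of ỹ has an anchor: take a simple path in G(ỹ) to the
  -- representative of its component; it has at most l ≤ l + 1 vertices.
  anchor-of : (y : Vec (Fin P) l) (reps : Vec (Fin P) r) →
              ((v : Fin P) → Vertex y v → ∃ λ (k : Fin r) → Connected S' y v (lookup reps k)) →
              (i : Fin l) → Anchor reps (lookup y i)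
  anchor-of y reps cover i =
    let (k , connected)           = cover (lookup y i) (i , refl)
        (vs , path , uniq , vert) = simplify y connected
        (ss , d , ss∈S')          = walk-differences 0∈S' l path
                                      (m≤n⇒m≤1+n (simple-length y uniq vert))
    in anchor k ss d ss∈S'

  Counted : Vec (Fin P) l → Set
  Counted y = InPow B y × HasComponents S' y r

  Code : Set
  Code = Vec (Fin P) r × Vec (Fin r × Vec (Fin P) l) l

  label : ∀ {reps x} → Anchor reps x → Fin r × Vec (Fin P) l
  label a = component a , steps a

  code : (y : Vec (Fin P) l) → Counted y → Code
  code y (_ , reps , _ , _ , cover) = reps , tabulate (label ∘ anchor-of y reps cover)

  -- Each entry is recovered from its representative and its steps.
  code-injective : ∀ y y' (q : Counted y) (q' : Counted y') → code y q ≡ code y' q' → y ≡ y'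
  code-injective y y' (_ , reps , _ , _ , cover) (_ , reps' , _ , _ , cover') same =
    trans (sym (tabulate∘lookup y)) (trans (tabulate-cong same-entry) (tabulate∘lookup y'))
    where
    same-entry : ∀ i → lookup y i ≡ lookup y' i
    same-entry i =
      start-unique (walk a) (walk a')
        (cong₂ lookup (cong proj₁ same) (cong proj₁ same-label)) (cong proj₂ same-label)
      where
      a  = anchor-of y reps cover i
      a' = anchor-of y' reps' cover' i
      same-label : label a ≡ label a'
      same-label = begin
        label a                                                  ≡⟨ lookup∘tabulate (label ∘ anchor-of y reps cover) i ⟨
        lookup (tabulate (label ∘ anchor-of y reps cover)) i     ≡⟨ cong (λ c → lookup (proj₂ c) i) same ⟩
        lookup (tabulate (label ∘ anchor-of y' reps' cover')) i  ≡⟨ lookup∘tabulate (label ∘ anchor-of y' reps' cover') i ⟩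
        label a' ∎
        where open ≡-Reasoning

  labels : List (Fin r × Vec (Fin P) l)
  labels = cartesianProduct (allFin r) (vectorsOver (members S') l)

  codes : List Code
  codes = cartesianProduct (vectorsOver (members B) r) (vectorsOver labels l)

  code∈codes : ∀ y (q : Counted y) → code y q ∈ₗ codes
  code∈codes y q@(y∈B , reps , reps-vertex , _ , cover) =
    ∈-cartesianProduct⁺ (∈-vectorsOver reps rep∈B) (∈-vectorsOver (proj₂ (code y q)) label∈labels)
    where
    -- Representatives are vertices of G(ỹ), i.e. entries of ỹ, so lie in B.
    rep∈B : ∀ k → lookup reps k ∈ₗ members B
    rep∈B k = let (i , entry) = reps-vertex k in ∈-members (subst (_∈ B) entry (y∈B i))

    label∈labels : ∀ i → lookup (proj₂ (code y q)) i ∈ₗ labels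
    label∈labels i =
      let a = anchor-of y reps cover i in
      subst (_∈ₗ labels) (sym (lookup∘tabulate (label ∘ anchor-of y reps cover) i))
        (∈-cartesianProduct⁺ (∈-allFin (component a)) (∈-vectorsOver (steps a) (∈-members ∘ steps∈S' a)))

  length-codes : length codes ≡ ∣ B ∣ ^ r * (r * ∣ S' ∣ ^ l) ^ l
  length-codes = begin
    length codes
      ≡⟨ length-cartesianProductWith _,_ (vectorsOver (members B) r) (vectorsOver labels l) ⟩
    length (vectorsOver (members B) r) * length (vectorsOver labels l)
      ≡⟨ cong₂ _*_ (length-vectorsOver (members B) r) (length-vectorsOver labels l) ⟩
    length (members B) ^ r * length labels ^ l
      ≡⟨ cong₂ (λ b z → b ^ r * z ^ l) (length-members B)
           (length-cartesianProductWith _,_ (allFin r) (vectorsOver (members S') l)) ⟩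
    ∣ B ∣ ^ r * (length (allFin r) * length (vectorsOver (members S') l)) ^ l
      ≡⟨ cong₂ (λ m z → ∣ B ∣ ^ r * (m * z) ^ l) (length-tabulate {n = r} (λ k → k))
           (trans (length-vectorsOver (members S') l) (cong (_^ l) (length-members S'))) ⟩
    ∣ B ∣ ^ r * (r * ∣ S' ∣ ^ l) ^ l ∎
    where open ≡-Reasoning

  count-by-components : CountAtMost Counted (∣ B ∣ ^ r * (r * ∣ S' ∣ ^ l) ^ l)
  count-by-components =
    subst (CountAtMost Counted) length-codes (count-by-encoding code code-injective codes code∈codes)

-- The numerical estimate

C-positive : ∀ {k n} → k ≤ n → 1 ≤ n C k
C-positive {zero}  z≤n       = ≤-refl
C-positive {suc k} {suc n} (s≤s k≤n) =
  subst (1 ≤_) (nCk+nC[k+1]≡[n+1]C[k+1] n k) (≤-trans (C-positive k≤n) (m≤m+n (n C k) (n C suc k)))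

base-bound : (l r s t : ℕ) .{{_ : NonZero r}} .{{_ : NonZero t}} → s ≤ t →
             r * s ^ l ≤ (r * t) ^ suc l
base-bound l r s t s≤t = begin
  r * s ^ l             ≤⟨ *-monoʳ-≤ r (^-monoˡ-≤ l s≤t) ⟩
  r * t ^ l             ≤⟨ *-mono-≤ (m≤m*n r t) (^-monoˡ-≤ l (m≤n*m t r)) ⟩
  (r * t) * (r * t) ^ l ∎
  where open ≤-Reasoning

exponent-bound : (l : ℕ) .{{_ : NonZero l}} → suc l * l ≤ 2 * (l * l)
exponent-bound l = begin
  l + l * l       ≤⟨ +-monoˡ-≤ (l * l) (m≤m*n l l) ⟩
  l * l + l * l   ≡⟨ cong (l * l +_) (+-identityʳ (l * l)) ⟨
  2 * (l * l)     ∎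
  where open ≤-Reasoning

code-count-bound : (l r s t b c : ℕ) .{{_ : NonZero l}} .{{_ : NonZero r}} .{{_ : NonZero t}}
                   .{{_ : NonZero c}} → s ≤ t →
                   b ^ r * (r * s ^ l) ^ l ≤ c * (r * t) ^ (2 * (l * l)) * b ^ r
code-count-bound l r s t b c s≤t = begin
  b ^ r * (r * s ^ l) ^ l        ≤⟨ *-monoʳ-≤ (b ^ r) (^-monoˡ-≤ l (base-bound l r s t s≤t)) ⟩
  b ^ r * ((r * t) ^ suc l) ^ l  ≡⟨ cong (b ^ r *_) (^-*-assoc (r * t) (suc l) l) ⟩
  b ^ r * (r * t) ^ (suc l * l)  ≤⟨ *-monoʳ-≤ (b ^ r) (^-monoʳ-≤ (r * t) {{m*n≢0 r t}} (exponent-bound l)) ⟩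
  b ^ r * Z                      ≡⟨ *-comm (b ^ r) Z ⟩
  Z * b ^ r                      ≤⟨ *-monoˡ-≤ (b ^ r) (m≤n*m Z c) ⟩
  c * Z * b ^ r                  ∎
  where
  open ≤-Reasoning
  Z = (r * t) ^ (2 * (l * l))

lemma6 : (P : ℕ) .{{_ : NonZero P}} (t : ℕ) (S' : Subset P) →
         ((x : Fin P) → x ∈ S' → negP P x ∈ S') →
         zeroP P ∈ S' →
         ∣ S' ∣ ≤ t →
         (B : Subset P) (l r : ℕ) → 1 ≤ l → 1 ≤ r → r ≤ l →
         CountAtMost {Vec (Fin P) l} (λ y → InPow B y × HasComponents S' y r)
           ((l C r) * (r * t) ^ (2 * (l * l)) * ∣ B ∣ ^ r)
lemma6 P t S' _ 0∈S' |S'|≤t B l r 1≤l 1≤r r≤l =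
  count-weaken (code-count-bound l r (∣ S' ∣) t (∣ B ∣) (l C r) |S'|≤t)
    (ComponentCode.count-by-components P S' 0∈S' B l r)
  where
  instance
    l≢0 : NonZero l
    l≢0 = >-nonZero 1≤l
    r≢0 : NonZero r
    r≢0 = >-nonZero 1≤r
    t≢0 : NonZero t
    t≢0 = >-nonZero (≤-trans (member⇒size-positive 0∈S') |S'|≤t)
    lCr≢0 : NonZero (l C r)
    lCr≢0 = >-nonZero (C-positive r≤l)
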